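{- Let $\alpha$ and $n$ be positive integers, and let $\mathfrak{A}^{(\alpha;n)}=(a_{k,r})$ be the symmetric $(\alpha;n)$-Gibonacci triangle. Then for each $k\ge0$ and each $r\in\mathcal{I}_{n,k}$ we have $a_{k,r}=a_{k,-r}$. Moreover, all regular entries of $\mathfrak{A}^{(\alpha;n)}$ are positive integers if and only if $n>\alpha$.
   Context: For each integer $k\ge0$ let $\mathcal{I}_{n,k}=\{ -k(n-1),-k(n-1)+2,\ldots,k(n-1)-2,k(n-1)\}$. Define integers $a_{k,r}=a^{(\alpha;n)}_{k,r}$ for $k\ge0$, $r\in\mathbb{Z}$: $a_{k,r}=0$ if $r\notin\mathcal{I}_{n,k}$; $a_{0,0}=\alpha$; $a_{1,r}=1$ for each $r\in\mathcal{I}_{n,1}$; and for $k\ge2$, $a_{k,r}=\left(\sum_{s\in\mathcal{I}_{n,1}}a_{k-1,r+s}\right)-a_{k-2,r}$. The array $(a_{k,r})$ is the symmetric $(\alpha;n)$-Gibonacci triangle; an entry $a_{k,r}$ with $r\in\mathcal{I}_{n,k}$ is called regular. -}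

module Defs where

open import Data.Nat as ℕ using (ℕ; zero; suc; _∸_)
open import Data.Integer as ℤ using (ℤ; +_; -_; _+_; _-_)
open import Data.List using (List; map; upTo; foldr)
open import Data.List.Membership.DecPropositional ℤ._≟_ using (_∈_; _∈?_)
open import Relation.Nullary using (does)
open import Data.Bool using (if_then_else_)

I : ℕ → ℕ → List ℤ
I n k = map (λ j → (- (+ (k ℕ.* (n ∸ 1)))) + (+ (2 ℕ.* j))) (upTo (suc (k ℕ.* (n ∸ 1))))

sumℤ : List ℤ → ℤ
sumℤ = foldr _+_ (+ 0)

gib : (α n : ℕ) → ℕ → ℤ → ℤ
gib α n zero r =
  if does (r ∈? I n zero) then + α else + 0
gib α n (suc zero) r =
  if does (r ∈? I n 1) then + 1 else + 0
gib α n (suc (suc k)) r =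
  if does (r ∈? I n (suc (suc k)))
  then sumℤ (map (λ s → gib α n (suc k) (r + s)) (I n 1)) - gib α n k r
  else + 0

module Submission where

-- The window I_{n,1} is closed
-- under negation, so the window sums of a symmetric row form a symmetric row.
-- For positivity with n > α one carries, with the positivity of two consecutive
-- rows, the domination a_{k,r} ≤ a_{k+1,r+s} for all s ∈ I_{n,1}. A window has
-- n ≥ 2 entries; for u ∈ I_{n,k+2} one of them lies in I_{n,k+1} and is positive,
-- the others are ≥ a_{k,u}, so a_{k+2,u} = (window sum) − a_{k,u} is at least that
-- positive entry; the same estimate propagates the domination. The only delicate
-- base entry is the centre a_{2,0} = n − α, which is also where n > α is forced.

open import Defs
open import Data.Nat as ℕ using (ℕ; zero; suc; _∸_)
open import Data.Integer as ℤ using (ℤ; +_; -_)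
open import Data.List using (List; []; _∷_; map; upTo; applyUpTo; applyDownFrom; reverse; length)
open import Data.List.Properties
  using (map-∘; map-cong; map-cong-local; map-upTo; length-map; length-upTo; reverse-applyUpTo; reverse-map)
open import Data.List.Membership.Propositional using (_∈_; _∉_)
open import Data.List.Membership.DecPropositional ℤ._≟_ using (_∈?_)
import Data.List.Membership.Propositional.Properties as ∈
open import Data.List.Relation.Unary.Any using (here; there)
open import Data.List.Relation.Unary.All as All using (All; []; _∷_)
import Data.List.Relation.Unary.All.Properties as All
open import Data.List.Relation.Binary.Permutation.Propositional using (_↭_; ↭⇒↭ₛ)
open import Data.List.Relation.Binary.Permutation.Propositional.Properties using (↭-reverse)
open import Data.List.Relation.Binary.Permutation.Setoid.Properties using (foldr-commMonoid)
open import Function using (_∘_)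
open import Data.Product using (_×_; _,_; ∃-syntax)
open import Data.Sum using (inj₁; inj₂)
open import Relation.Nullary using (Dec; yes; no)
open import Relation.Nullary.Decidable using (dec-true; dec-false)
import Data.Nat.Properties as ℕ
import Data.Integer.Properties as ℤ
open import Data.Integer.Tactic.RingSolver using (solve-∀)
open import Relation.Binary.Core using (_Preserves_⟶_)
open import Relation.Binary.PropositionalEquality
open import Function.Bundles using (_⇔_; mk⇔; Equivalence)
open import Algebra.Properties.AbelianGroup ℤ.+-0-abelianGroup using (⁻¹-anti-homo‿-)

sumℤ-↭ : sumℤ Preserves _↭_ ⟶ _≡_
sumℤ-↭ p = foldr-commMonoid (setoid ℤ) ℤ.+-0-isCommutativeMonoid (↭⇒↭ₛ p)

sumℤ-ones : ∀ {xs} → All (_≡ + 1) xs → sumℤ xs ≡ + length xs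
sumℤ-ones [] = refl
sumℤ-ones (refl ∷ ps) = cong (ℤ._+_ (+ 1)) (sumℤ-ones ps)

sumℤ-nonneg : ∀ {xs} → All (+ 0 ℤ.≤_) xs → + 0 ℤ.≤ sumℤ xs
sumℤ-nonneg [] = ℤ.≤-refl
sumℤ-nonneg (p ∷ ps) = ℤ.+-mono-≤ p (sumℤ-nonneg ps)

∈⇒≤sumℤ : ∀ {x xs} → All (+ 0 ℤ.≤_) xs → x ∈ xs → x ℤ.≤ sumℤ xs
∈⇒≤sumℤ {x} {_ ∷ ys} (_ ∷ ps) (here refl) = ℤ.i≤i+j x (sumℤ ys) {{ℤ.nonNegative (sumℤ-nonneg ps)}}
∈⇒≤sumℤ {_} {y ∷ _} (p ∷ ps) (there x∈) = ℤ.≤-trans (∈⇒≤sumℤ ps x∈) (ℤ.i≤j+i _ y {{ℤ.nonNegative p}})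

∈⇒+≤sumℤ : ∀ {c x xs} → + 0 ℤ.≤ c → All (c ℤ.≤_) xs → x ∈ xs → 2 ℕ.≤ length xs →
           x ℤ.+ c ℤ.≤ sumℤ xs
∈⇒+≤sumℤ {c} {x} {_ ∷ y ∷ ys} 0≤c (_ ∷ c≤y ∷ cs) (here refl) _ =
  ℤ.+-monoʳ-≤ x (ℤ.≤-trans c≤y (ℤ.i≤i+j y (sumℤ ys) {{ℤ.nonNegative 0≤Σys}}))
  where
  0≤Σys : + 0 ℤ.≤ sumℤ ys
  0≤Σys = sumℤ-nonneg (All.map (ℤ.≤-trans 0≤c) cs)
∈⇒+≤sumℤ {xs = _ ∷ []} _ _ (here _) (ℕ.s≤s ())
∈⇒+≤sumℤ {c} {x} 0≤c (c≤y ∷ cs) (there x∈) _ =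
  subst (ℤ._≤ _) (ℤ.+-comm c x) (ℤ.+-mono-≤ c≤y (∈⇒≤sumℤ (All.map (ℤ.≤-trans 0≤c) cs) x∈))

i+j≤k⇒i≤k-j : ∀ {i j k} → i ℤ.+ j ℤ.≤ k → i ℤ.≤ k ℤ.- j
i+j≤k⇒i≤k-j {i} {j} i+j≤k = subst (ℤ._≤ _) (cancel i j) (ℤ.+-monoˡ-≤ (- j) i+j≤k)
  where
  cancel : ∀ a b → a ℤ.+ b ℤ.- b ≡ a
  cancel = solve-∀

i≤k-j⇒i+j≤k : ∀ {i j k} → i ℤ.≤ k ℤ.- j → i ℤ.+ j ℤ.≤ k
i≤k-j⇒i+j≤k {i} {j} {k} i≤k-j = subst (_ ℤ.≤_) (cancel k j) (ℤ.+-monoˡ-≤ j i≤k-j)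
  where
  cancel : ∀ a b → a ℤ.- b ℤ.+ b ≡ a
  cancel = solve-∀

0<n-m⇔m<n : ∀ {m n} → + 0 ℤ.< + n ℤ.- + m ⇔ m ℕ.< n
0<n-m⇔m<n {m} = mk⇔ (λ 0<n-m → ℤ.drop‿+≤+ (i≤k-j⇒i+j≤k {+ 1} {+ m} (ℤ.i<j⇒suc[i]≤j 0<n-m)))
                (λ m<n → ℤ.suc[i]≤j⇒i<j (i+j≤k⇒i≤k-j {+ 1} {+ m} (ℤ.+≤+ m<n)))

term : ℕ → ℕ → ℤ
term K j = - (+ K) ℤ.+ + (2 ℕ.* j)

term≡diff : ∀ i j {K} → i ℕ.+ j ≡ K → term K j ≡ + j ℤ.- + i
term≡diff i j refl = begin
  - (+ (i ℕ.+ j)) ℤ.+ + (2 ℕ.* j)    ≡⟨ cong₂ (λ a b → - a ℤ.+ b) (ℤ.pos-+ i j) (ℤ.pos-* 2 j) ⟩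
  - (+ i ℤ.+ + j) ℤ.+ + 2 ℤ.* + j    ≡⟨ ring (+ i) (+ j) ⟩
  + j ℤ.- + i                        ∎
  where
  open ≡-Reasoning
  ring : ∀ a b → - (a ℤ.+ b) ℤ.+ + 2 ℤ.* b ≡ b ℤ.- a
  ring = solve-∀

-- With K = k(n − 1), I_{n,k} = progression K consists of the r = j − i with i + j = K.
data Progression (K : ℕ) : ℤ → Set where
  diff : ∀ i j → i ℕ.+ j ≡ K → Progression K (+ j ℤ.- + i)

Progression-neg : ∀ {K r} → Progression K r → Progression K (- r)
Progression-neg {K} (diff i j e) =
  subst (Progression K) (sym (⁻¹-anti-homo‿- (+ j) (+ i))) (diff j i (trans (ℕ.+-comm j i) e))

Progression-+ : ∀ {K L r s} → Progression K r → Progression L s → Progression (K ℕ.+ L) (r ℤ.+ s)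
Progression-+ (diff i j refl) (diff i′ j′ refl) =
  subst (Progression _) sum≡ (diff (i ℕ.+ i′) (j ℕ.+ j′) (interchange i i′ j j′))
  where
  open import Algebra.Properties.CommutativeSemigroup ℕ.+-commutativeSemigroup using (interchange)
  ring : ∀ a b c d → (c ℤ.+ d) ℤ.- (a ℤ.+ b) ≡ (c ℤ.- a) ℤ.+ (d ℤ.- b)
  ring = solve-∀
  sum≡ : + (j ℕ.+ j′) ℤ.- + (i ℕ.+ i′) ≡ (+ j ℤ.- + i) ℤ.+ (+ j′ ℤ.- + i′)
  sum≡ rewrite ℤ.pos-+ j j′ | ℤ.pos-+ i i′ = ring (+ i) (+ i′) (+ j) (+ j′)

Progression-split : ∀ {L K u} → Progression (L ℕ.+ K) u → ∃[ s ] Progression L s × Progression K (u ℤ.+ s)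
Progression-split {L} {K} (diff i j e) with ℕ.≤-total L i
... | inj₁ L≤i with ℕ.m≤n⇒∃[o]m+o≡n L≤i
...   | i′ , refl = + L ℤ.- + 0 , diff 0 L refl ,
        subst (Progression K) (shift (+ L) (+ i′) (+ j))
          (diff i′ j (ℕ.+-cancelˡ-≡ L _ _ (trans (sym (ℕ.+-assoc L i′ j)) e)))
  where
  shift : ∀ a b c → c ℤ.- b ≡ (c ℤ.- (a ℤ.+ b)) ℤ.+ (a ℤ.- + 0)
  shift = solve-∀
Progression-split {L} {K} (diff i j e) | inj₂ i≤L with ℕ.m≤n⇒∃[o]m+o≡n i≤L
... | d , refl with ℕ.+-cancelˡ-≡ i j (d ℕ.+ K) (trans e (ℕ.+-assoc i d K))
...   | refl = + i ℤ.- + d , diff d i (ℕ.+-comm d i) ,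
        subst (Progression K) (shift (+ d) (+ K) (+ i)) (diff 0 K refl)
  where
  shift : ∀ a b c → b ℤ.- + 0 ≡ ((a ℤ.+ b) ℤ.- c) ℤ.+ (c ℤ.- a)
  shift = solve-∀

progression : ℕ → List ℤ
progression K = map (term K) (upTo (suc K))

∈progression⇒Progression : ∀ K {r} → r ∈ progression K → Progression K r
∈progression⇒Progression K r∈ with ∈.∈-map⁻ (term K) r∈
... | j , j∈ , refl = subst (Progression K) (sym (term≡diff (K ∸ j) j i+j≡K)) (diff (K ∸ j) j i+j≡K)
  where
  i+j≡K : K ∸ j ℕ.+ j ≡ K
  i+j≡K = ℕ.m∸n+n≡m (ℕ.≤-pred (∈.∈-upTo⁻ j∈))

Progression⇒∈progression : ∀ {K r} → Progression K r → r ∈ progression K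
Progression⇒∈progression {K} (diff i j e) =
  subst (_∈ progression K) (term≡diff i j e) (∈.∈-map⁺ (term K) (∈.∈-upTo⁺ (ℕ.s≤s j≤K)))
  where
  j≤K : j ℕ.≤ K
  j≤K = subst (j ℕ.≤_) e (ℕ.m≤n+m j i)

length-progression : ∀ K → length (progression K) ≡ suc K
length-progression K = trans (length-map (term K) (upTo (suc K))) (length-upTo (suc K))

applyDownFrom≡applyUpTo : ∀ {A : Set} (f : ℕ → A) N → applyDownFrom f N ≡ applyUpTo (λ j → f (N ∸ suc j)) N
applyDownFrom≡applyUpTo f zero = refl
applyDownFrom≡applyUpTo f (suc N) = cong (f N ∷_) (applyDownFrom≡applyUpTo f N)

neg-term : ∀ {K j} → j ℕ.≤ K → - term K j ≡ term K (K ∸ j)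
neg-term {K} {j} j≤K = begin
  - term K j                  ≡⟨ cong -_ (term≡diff (K ∸ j) j (ℕ.m∸n+n≡m j≤K)) ⟩
  - (+ j ℤ.- + (K ∸ j))       ≡⟨ ⁻¹-anti-homo‿- (+ j) (+ (K ∸ j)) ⟩
  + (K ∸ j) ℤ.- + j           ≡⟨ term≡diff j (K ∸ j) (ℕ.m+[n∸m]≡n j≤K) ⟨
  term K (K ∸ j)              ∎
  where open ≡-Reasoning

map-neg-progression : ∀ K → map -_ (progression K) ≡ reverse (progression K)
map-neg-progression K = begin
  map -_ (map (term K) (upTo (suc K)))            ≡⟨ map-∘ (upTo (suc K)) ⟨
  map (-_ ∘ term K) (upTo (suc K))                ≡⟨ map-cong-local (All.tabulate (neg-term ∘ ℕ.≤-pred ∘ ∈.∈-upTo⁻)) ⟩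
  map (λ j → term K (K ∸ j)) (upTo (suc K))       ≡⟨ map-upTo _ (suc K) ⟩
  applyUpTo (λ j → term K (K ∸ j)) (suc K)        ≡⟨ applyDownFrom≡applyUpTo (term K) (suc K) ⟨
  applyDownFrom (term K) (suc K)                  ≡⟨ reverse-applyUpTo (term K) (suc K) ⟨
  reverse (applyUpTo (term K) (suc K))            ≡⟨ cong reverse (map-upTo (term K) (suc K)) ⟨
  reverse (map (term K) (upTo (suc K)))           ∎
  where open ≡-Reasoning

module Triangle (α n : ℕ) where

  a : ℕ → ℤ → ℤ
  a = gib α n

  ∈I⇒Progression : ∀ k {r} → r ∈ I n k → Progression (k ℕ.* (n ∸ 1)) r
  ∈I⇒Progression k = ∈progression⇒Progression (k ℕ.* (n ∸ 1))

  Progression⇒∈I : ∀ k {r} → Progression (k ℕ.* (n ∸ 1)) r → r ∈ I n k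
  Progression⇒∈I k = Progression⇒∈progression

  ∈I-neg : ∀ k {r} → r ∈ I n k → - r ∈ I n k
  ∈I-neg k r∈ = Progression⇒∈I k (Progression-neg (∈I⇒Progression k r∈))

  ∈I-neg⁻ : ∀ k {r} → - r ∈ I n k → r ∈ I n k
  ∈I-neg⁻ k {r} -r∈ = subst (_∈ I n k) (ℤ.neg-involutive r) (∈I-neg k -r∈)

  ∈I-+ : ∀ k {r s} → r ∈ I n k → s ∈ I n 1 → r ℤ.+ s ∈ I n (suc k)
  ∈I-+ k {r} {s} r∈ s∈ = Progression⇒∈I (suc k)
    (subst₂ Progression (sym (ℕ.*-distribʳ-+ (n ∸ 1) 1 k)) (ℤ.+-comm s r)
      (Progression-+ (∈I⇒Progression 1 s∈) (∈I⇒Progression k r∈)))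

  ∈I-split : ∀ k {u} → u ∈ I n (suc k) → ∃[ s ] s ∈ I n 1 × u ℤ.+ s ∈ I n k
  ∈I-split k u∈ with Progression-split (∈I⇒Progression (suc k) u∈)
  ... | s , s∈P , us∈P =
    s , Progression⇒∈I 1 (subst (λ K → Progression K s) (sym (ℕ.*-identityˡ (n ∸ 1))) s∈P) ,
    Progression⇒∈I k us∈P

  0∈I₀ : + 0 ∈ I n 0
  0∈I₀ = Progression⇒∈I 0 (diff 0 0 refl)

  ∈I₀⇒≡0 : ∀ {r} → r ∈ I n 0 → r ≡ + 0
  ∈I₀⇒≡0 r∈ with ∈I⇒Progression 0 r∈
  ... | diff zero zero refl = refl

  0∈I₂ : + 0 ∈ I n 2
  0∈I₂ = subst (_∈ I n 2) (ℤ.+-inverseʳ (+ (n ∸ 1)))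
    (Progression⇒∈I 2 (diff (n ∸ 1) (n ∸ 1) (cong ((n ∸ 1) ℕ.+_) (sym (ℕ.+-identityʳ (n ∸ 1))))))

  length-I₁ : 1 ℕ.≤ n → length (I n 1) ≡ n
  length-I₁ 1≤n = begin
    length (progression (1 ℕ.* (n ∸ 1)))   ≡⟨ length-progression (1 ℕ.* (n ∸ 1)) ⟩
    suc (1 ℕ.* (n ∸ 1))                    ≡⟨ cong suc (ℕ.*-identityˡ (n ∸ 1)) ⟩
    suc (n ∸ 1)                            ≡⟨ ℕ.m+[n∸m]≡n 1≤n ⟩
    n                                      ∎
    where open ≡-Reasoning

  window : (ℤ → ℤ) → ℤ → ℤ
  window G r = sumℤ (map (λ s → G (r ℤ.+ s)) (I n 1))

  gib-outside : ∀ k {r} → r ∉ I n k → a k r ≡ + 0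
  gib-outside zero {r} r∉ rewrite dec-false (r ∈? I n 0) r∉ = refl
  gib-outside (suc zero) {r} r∉ rewrite dec-false (r ∈? I n 1) r∉ = refl
  gib-outside (suc (suc k)) {r} r∉ rewrite dec-false (r ∈? I n (suc (suc k))) r∉ = refl

  gib-row₀ : ∀ {r} → r ∈ I n 0 → a 0 r ≡ + α
  gib-row₀ {r} r∈ rewrite dec-true (r ∈? I n 0) r∈ = refl

  gib-row₁ : ∀ {r} → r ∈ I n 1 → a 1 r ≡ + 1
  gib-row₁ {r} r∈ rewrite dec-true (r ∈? I n 1) r∈ = refl

  gib-recurrence : ∀ k {r} → r ∈ I n (suc (suc k)) → a (suc (suc k)) r ≡ window (a (suc k)) r ℤ.- a k r
  gib-recurrence k {r} r∈ rewrite dec-true (r ∈? I n (suc (suc k))) r∈ = refl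

  Symmetric : ℕ → Set
  Symmetric k = ∀ r → a k (- r) ≡ a k r

  symmetric-on-I⇒Symmetric : ∀ k → (∀ {r} → r ∈ I n k → a k (- r) ≡ a k r) → Symmetric k
  symmetric-on-I⇒Symmetric k sym-on-I r with r ∈? I n k
  ... | yes r∈ = sym-on-I r∈
  ... | no r∉ = trans (gib-outside k (r∉ ∘ ∈I-neg⁻ k)) (sym (gib-outside k r∉))

  window-neg : ∀ {G} → (∀ x → G (- x) ≡ G x) → ∀ r → window G (- r) ≡ window G r
  window-neg {G} G-sym r = begin
    sumℤ (map (λ s → G (- r ℤ.+ s)) (I n 1))             ≡⟨ cong sumℤ (map-cong reflect (I n 1)) ⟩
    sumℤ (map (λ s → G (r ℤ.+ - s)) (I n 1))             ≡⟨ cong sumℤ (map-∘ {g = Gr} {f = -_} (I n 1)) ⟩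
    sumℤ (map Gr (map -_ (I n 1)))                        ≡⟨ cong (sumℤ ∘ map Gr) (map-neg-progression (1 ℕ.* (n ∸ 1))) ⟩
    sumℤ (map Gr (reverse (I n 1)))                       ≡⟨ cong sumℤ (reverse-map Gr (I n 1)) ⟩
    sumℤ (reverse (map Gr (I n 1)))                       ≡⟨ sumℤ-↭ (↭-reverse (map Gr (I n 1))) ⟩
    sumℤ (map Gr (I n 1))                                 ∎
    where
    open ≡-Reasoning
    Gr : ℤ → ℤ
    Gr s = G (r ℤ.+ s)
    reflect : ∀ s → G (- r ℤ.+ s) ≡ G (r ℤ.+ - s)
    reflect s = trans (sym (G-sym _)) (cong G (trans (ℤ.neg-distrib-+ (- r) s) (cong (ℤ._+ - s) (ℤ.neg-involutive r))))

  symmetric : ∀ k → Symmetric k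
  symmetric zero =
    symmetric-on-I⇒Symmetric 0 (λ r∈ → trans (gib-row₀ (∈I-neg 0 r∈)) (sym (gib-row₀ r∈)))
  symmetric (suc zero) =
    symmetric-on-I⇒Symmetric 1 (λ r∈ → trans (gib-row₁ (∈I-neg 1 r∈)) (sym (gib-row₁ r∈)))
  symmetric (suc (suc k)) = symmetric-on-I⇒Symmetric (suc (suc k)) λ {r} r∈ → begin
    a (suc (suc k)) (- r)                         ≡⟨ gib-recurrence k (∈I-neg (suc (suc k)) r∈) ⟩
    window (a (suc k)) (- r) ℤ.- a k (- r)
      ≡⟨ cong₂ ℤ._-_ (window-neg (symmetric (suc k)) r) (symmetric k r) ⟩
    window (a (suc k)) r ℤ.- a k r                ≡⟨ gib-recurrence k r∈ ⟨
    a (suc (suc k)) r                             ∎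
    where open ≡-Reasoning

  Positive : ℕ → Set
  Positive k = ∀ {r} → r ∈ I n k → + 0 ℤ.< a k r

  Positive⇒nonneg : ∀ k → Positive k → ∀ r → + 0 ℤ.≤ a k r
  Positive⇒nonneg k pos r with r ∈? I n k
  ... | yes r∈ = ℤ.<⇒≤ (pos r∈)
  ... | no r∉ = ℤ.≤-reflexive (sym (gib-outside k r∉))

  Dominated : ℕ → Set
  Dominated k = ∀ r {s} → s ∈ I n 1 → a k r ℤ.≤ a (suc k) (r ℤ.+ s)

  window-entry≤gib : 2 ℕ.≤ n → ∀ k {u x} → + 0 ℤ.≤ a k u →
    (∀ {s} → s ∈ I n 1 → a k u ℤ.≤ a (suc k) (u ℤ.+ s)) →
    x ∈ I n 1 → u ∈ I n (suc (suc k)) → a (suc k) (u ℤ.+ x) ℤ.≤ a (suc (suc k)) u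
  window-entry≤gib 2≤n k {u} {x} 0≤aku aku≤ x∈ u∈ =
    subst (a (suc k) (u ℤ.+ x) ℤ.≤_) (sym (gib-recurrence k u∈))
      (i+j≤k⇒i≤k-j (∈⇒+≤sumℤ 0≤aku (All.map⁺ (All.tabulate aku≤)) (∈.∈-map⁺ G x∈) 2≤length))
    where
    G : ℤ → ℤ
    G s = a (suc k) (u ℤ.+ s)
    2≤length : 2 ℕ.≤ length (map G (I n 1))
    2≤length = subst (2 ℕ.≤_) (sym (trans (length-map G (I n 1)) (length-I₁ (ℕ.<⇒≤ 2≤n)))) 2≤n

  positive-entry : 2 ℕ.≤ n → ∀ k {u} → Positive (suc k) → + 0 ℤ.≤ a k u →
    (∀ {s} → s ∈ I n 1 → a k u ℤ.≤ a (suc k) (u ℤ.+ s)) →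
    u ∈ I n (suc (suc k)) → + 0 ℤ.< a (suc (suc k)) u
  positive-entry 2≤n k pos 0≤aku aku≤ u∈ with ∈I-split (suc k) u∈
  ... | x , x∈ , ux∈ = ℤ.<-≤-trans (pos ux∈) (window-entry≤gib 2≤n k 0≤aku aku≤ x∈ u∈)

  Positive-step : 2 ℕ.≤ n → ∀ k → Positive k → Positive (suc k) → Dominated k → Positive (suc (suc k))
  Positive-step 2≤n k pos pos′ dom {u} = positive-entry 2≤n k pos′ (Positive⇒nonneg k pos u) (dom u)

  Dominated-step : 2 ℕ.≤ n → ∀ k → Positive k → Dominated k → Dominated (suc k)
  Dominated-step 2≤n k pos dom r {s} s∈ with r ℤ.+ s ∈? I n (suc (suc k))
  ... | yes rs∈ = subst (λ t → a (suc k) t ℤ.≤ a (suc (suc k)) (r ℤ.+ s)) (cancel r s)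
          (window-entry≤gib 2≤n k {r ℤ.+ s} { - s} (Positive⇒nonneg k pos _) (dom _) (∈I-neg 1 s∈) rs∈)
    where
    cancel : ∀ x y → x ℤ.+ y ℤ.+ - y ≡ x
    cancel = solve-∀
  ... | no rs∉ = ℤ.≤-reflexive (trans (gib-outside (suc k) r∉) (sym (gib-outside (suc (suc k)) rs∉)))
    where
    r∉ : r ∉ I n (suc k)
    r∉ r∈ = rs∉ (∈I-+ (suc k) r∈ s∈)

  central-entry : 1 ℕ.≤ n → a 2 (+ 0) ≡ + n ℤ.- + α
  central-entry 1≤n = begin
    a 2 (+ 0)                          ≡⟨ gib-recurrence 0 0∈I₂ ⟩
    window (a 1) (+ 0) ℤ.- a 0 (+ 0)   ≡⟨ cong₂ ℤ._-_ window-ones (gib-row₀ 0∈I₀) ⟩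
    + n ℤ.- + α                        ∎
    where
    open ≡-Reasoning
    ones : ∀ {s} → s ∈ I n 1 → a 1 (+ 0 ℤ.+ s) ≡ + 1
    ones {s} s∈ = gib-row₁ (subst (_∈ I n 1) (sym (ℤ.+-identityˡ s)) s∈)
    window-ones : window (a 1) (+ 0) ≡ + n
    window-ones = trans (sumℤ-ones (All.map⁺ (All.tabulate ones)))
                        (cong +_ (trans (length-map _ (I n 1)) (length-I₁ 1≤n)))

  Positive₂⇒α<n : 1 ℕ.≤ n → Positive 2 → α ℕ.< n
  Positive₂⇒α<n 1≤n pos = Equivalence.to 0<n-m⇔m<n (subst (+ 0 ℤ.<_) (central-entry 1≤n) (pos 0∈I₂))

  module _ (1≤α : 1 ℕ.≤ α) (α<n : α ℕ.< n) where

    2≤n : 2 ℕ.≤ n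
    2≤n = ℕ.≤-trans (ℕ.s≤s 1≤α) α<n

    positive₀ : Positive 0
    positive₀ r∈ rewrite gib-row₀ r∈ = ℤ.+<+ 1≤α

    positive₁ : Positive 1
    positive₁ r∈ rewrite gib-row₁ r∈ = ℤ.+<+ (ℕ.s≤s ℕ.z≤n)

    positive₂ : Positive 2
    positive₂ {u} u∈ = by-cases (u ℤ.≟ + 0)
      -- a 'with' on u ≟ 0 would also abstract the same test inside the unfolded gib
      where
      by-cases : Dec (u ≡ + 0) → + 0 ℤ.< a 2 u
      by-cases (yes refl) = subst (+ 0 ℤ.<_) (sym (central-entry (ℕ.<⇒≤ 2≤n))) (Equivalence.from 0<n-m⇔m<n α<n)
      by-cases (no u≢0) = positive-entry 2≤n 0 positive₁ (ℤ.≤-reflexive (sym a₀u≡0))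
                            (λ _ → subst (ℤ._≤ _) (sym a₀u≡0) (Positive⇒nonneg 1 positive₁ _)) u∈
        where
        a₀u≡0 : a 0 u ≡ + 0
        a₀u≡0 = gib-outside 0 (u≢0 ∘ ∈I₀⇒≡0)

    dominated₁ : Dominated 1
    dominated₁ r {s} s∈ with r ∈? I n 1
    ... | yes r∈ =
      subst (ℤ._≤ a 2 (r ℤ.+ s)) (sym (gib-row₁ r∈)) (ℤ.i<j⇒suc[i]≤j (positive₂ {r ℤ.+ s} (∈I-+ 1 r∈ s∈)))
    ... | no r∉ = subst (ℤ._≤ a 2 (r ℤ.+ s)) (sym (gib-outside 1 r∉)) (Positive⇒nonneg 2 positive₂ (r ℤ.+ s))

    positive : ∀ k → Positive k
    dominated : ∀ k → Dominated (suc k)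

    positive zero = positive₀
    positive (suc zero) = positive₁
    positive (suc (suc zero)) = positive₂
    positive (suc (suc (suc k))) = Positive-step 2≤n (suc k) (positive (suc k)) (positive (suc (suc k))) (dominated k)

    dominated zero = dominated₁
    dominated (suc k) = Dominated-step 2≤n (suc k) (positive (suc k)) (dominated k)

proposition5p3 : (α n : ℕ) → 1 ℕ.≤ α → 1 ℕ.≤ n →
    ((k : ℕ) → (r : ℤ) → r ∈ I n k → gib α n k r ≡ gib α n k (- r))
    × (((k : ℕ) → (r : ℤ) → r ∈ I n k → + 0 ℤ.< gib α n k r) ⇔ (α ℕ.< n))
proposition5p3 α n 1≤α 1≤n =
  (λ k r _ → sym (symmetric k r)) ,
  mk⇔ (λ pos → Positive₂⇒α<n 1≤n (pos 2 _)) (λ α<n k r → positive 1≤α α<n k)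
  where open Triangle α n
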